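{- Let $S^p_{n,m}$ denote the $(n,m)$-th entry of the $p$-th power of the infinite lower triangular matrix $\mathcal{S}=(S_{n,m})_{n,m\ge0}$ of Stirling numbers of the second kind ($\mathcal{S}^0$ = identity). Define power series $\sigma^0(t)=t$, $\sigma^1(t)=e^t-1$, $\sigma^p(t)=\sigma^{p-1}(e^t-1)$ for $p>1$, let $E^p(t)=e^{\sigma^p(t)}$, and define the higher order Bell polynomials $B^p_n(x)$ by $\sum_{n\ge0}B^p_n(x)\frac{t^n}{n!}=(E^p(t))^x=e^{x\sigma^p(t)}$, i.e. $B^p_n(x)=n![t^n](E^p(t))^x$. Then: (i) for every $p\ge 0$ and $n\ge0$, $B^p_n(x)=\sum_{m=0}^n S^p_{n,m}x^m$; (ii) for every $p\ge1$ and all $n,m\ge0$, \[S^p_{n,m}=\frac{1}{m!}\sum_{k=0}^m\binom{m}{k}(-1)^{m-k}B^{p-1}_n(k).\]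
   Context: $S_{n,m}$ is the number of partitions of an $n$-set into $m$ nonempty blocks ($S_{n,m}=0$ for $m>n$). Note $B^0_n(x)=x^n$ and $B^1_n(x)$ is the classical Bell polynomial. -}

module Defs where

open import Data.Nat as ℕ using (ℕ; zero; suc; _!; _∸_)
open import Data.Nat.Properties using (_!≢0)
open import Data.Nat.Combinatorics using (_C_)
open import Data.Integer using (+_)
open import Data.Rational using (ℚ; 0ℚ; 1ℚ; _+_; _*_; -_; _/_)

ι : ℕ → ℚ
ι n = (+ n) / 1

sumTo : ℕ → (ℕ → ℚ) → ℚ
sumTo zero    f = f 0
sumTo (suc n) f = sumTo n f + f (suc n)

sumToℕ : ℕ → (ℕ → ℕ) → ℕ
sumToℕ zero    f = f 0
sumToℕ (suc n) f = sumToℕ n f ℕ.+ f (suc n)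

S : ℕ → ℕ → ℕ
S zero    zero    = 1
S zero    (suc m) = 0
S (suc n) zero    = 0
S (suc n) (suc m) = suc m ℕ.* S n (suc m) ℕ.+ S n m

δ : ℕ → ℕ → ℕ
δ zero    zero    = 1
δ zero    (suc m) = 0
δ (suc n) zero    = 0
δ (suc n) (suc m) = δ n m

-- Sᵖ n m : (n,m)-entry of the p-th power of the lower triangular matrix 𝒮.
-- 𝒮^{p+1} = 𝒮 · 𝒮^p ; since 𝒮 is lower triangular the row sum is over k ≤ n.
Sᵖ : ℕ → ℕ → ℕ → ℕ
Sᵖ zero    n m = δ n m
Sᵖ (suc p) n m = sumToℕ n (λ k → S n k ℕ.* Sᵖ p k m)

PS : Set
PS = ℕ → ℚ

_⊛_ : PS → PS → PS
(f ⊛ g) n = sumTo n (λ k → f k * g (n ∸ k))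

_^ˢ_ : PS → ℕ → PS
(f ^ˢ zero)  zero    = 1ℚ
(f ^ˢ zero)  (suc n) = 0ℚ
(f ^ˢ suc k)         = f ⊛ (f ^ˢ k)

-- composition f(g(t)) for g with zero constant term:
-- [t^n] f(g) = Σ_{k=0}^{n} f_k [t^n] g^k
_∘ˢ_ : PS → PS → PS
(f ∘ˢ g) n = sumTo n (λ k → f k * (g ^ˢ k) n)

_·ˢ_ : ℚ → PS → PS
(c ·ˢ f) n = c * f n

tˢ : PS
tˢ zero          = 0ℚ
tˢ (suc zero)    = 1ℚ
tˢ (suc (suc n)) = 0ℚ

expˢ : PS
expˢ n = _/_ (+ 1) (n !) ⦃ n !≢0 ⦄

expm1 : PS
expm1 zero    = 0ℚ
expm1 (suc n) = expˢ (suc n)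

σ : ℕ → PS
σ zero    = tˢ
σ (suc p) = σ p ∘ˢ expm1

B : ℕ → ℕ → ℚ → ℚ
B p n x = ι (n !) * (expˢ ∘ˢ (x ·ˢ σ p)) n

sign : ℕ → ℚ
sign zero    = 1ℚ
sign (suc k) = - sign k

_^q_ : ℚ → ℕ → ℚ
x ^q zero  = 1ℚ
x ^q suc m = x * (x ^q m)

-- For p = 0 the identity n! [tⁿ] σᵖ(t)ᵏ = k! Sᵖ_{n,k} just reads off the coefficients of tᵏ.
-- Composition with a series without constant term is multiplicative, so σᵖ⁺¹(t)ᵏ = σᵖ(t)ᵏ ∘ (eᵗ − 1);
-- combined with n! [tⁿ] (eᵗ − 1)ʲ = j! S_{n,j} (differentiate (eᵗ − 1)ʲ⁺¹) this multiplies the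
-- matrix by 𝒮, giving the identity for p + 1. Expanding e^{xσᵖ} = Σₖ xᵏ σᵖ(t)ᵏ / k! then yields (i).
-- For (ii), substitute (i) for B^{p−1}_n(k): the alternating sum turns into Σⱼ S^{p−1}_{n,j} Δᵐ[kʲ](0),
-- the m-th forward difference of k ↦ kʲ at 0 is m! S_{j,m}, and Σⱼ S^{p−1}_{n,j} S_{j,m} = S^p_{n,m}
-- because 𝒮 commutes with its powers.

module Submission where

open import Defs
open import Algebra.Bundles using (CommutativeMonoid)
import Algebra.Properties.CommutativeSemigroup as CommutativeSemigroupProperties
open import Data.Empty using (⊥-elim)
open import Data.Integer as ℤ using (+_)
import Data.Integer.Properties as ℤ
open import Data.Nat as ℕ using (ℕ; zero; suc; _≤_; _<_; _∸_; _!; z≤n; s≤s)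
open import Data.Nat.Combinatorics using (_C_; nCk+nC[k+1]≡[n+1]C[k+1]; k>n⇒nCk≡0; nCk≡n!/k![n-k]!; k![n∸k]!∣n!)
import Data.Nat.Coprimality as Coprime
open import Data.Nat.DivMod using (m/n*n≡m)
import Data.Nat.Properties as ℕ
open import Data.Nat.Properties using (_!≢0; _!*_!≢0)
import Data.Nat.Solver
open import Data.Product using (_×_; _,_)
open import Data.Rational using (ℚ; 0ℚ; 1ℚ; _+_; _*_; -_; _-_; _/_; mkℚ)
import Data.Rational.Properties as ℚ
import Data.Rational.Solver
open import Function using (_∘_)
open import Relation.Binary.PropositionalEquality
open import Relation.Nullary using (yes; no)

open ≡-Reasoning
module ℕS = Data.Nat.Solver.+-*-Solver
module ℚS = Data.Rational.Solver.+-*-Solver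
module *ᶜ = CommutativeSemigroupProperties (CommutativeMonoid.commutativeSemigroup ℚ.*-1-commutativeMonoid)
module +ᶜ = CommutativeSemigroupProperties (CommutativeMonoid.commutativeSemigroup ℚ.+-0-commutativeMonoid)

x≡0⇒x*y≡0 : ∀ {x} y → x ≡ 0ℚ → x * y ≡ 0ℚ
x≡0⇒x*y≡0 y refl = ℚ.*-zeroˡ y

y≡0⇒x*y≡0 : ∀ x {y} → y ≡ 0ℚ → x * y ≡ 0ℚ
y≡0⇒x*y≡0 x refl = ℚ.*-zeroʳ x

ι-mkℚ : ∀ n → ι n ≡ mkℚ (+ n) 0 (Coprime.sym (Coprime.1-coprimeTo n))
ι-mkℚ n = ℚ.normalize-coprime (Coprime.sym (Coprime.1-coprimeTo n))

ι-+ : ∀ a b → ι (a ℕ.+ b) ≡ ι a + ι b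
ι-+ a b = trans (cong (_/ 1) (cong₂ ℤ._+_ (sym (ℤ.*-identityʳ (+ a))) (sym (ℤ.*-identityʳ (+ b)))))
                (sym (cong₂ _+_ (ι-mkℚ a) (ι-mkℚ b)))

ι-* : ∀ a b → ι (a ℕ.* b) ≡ ι a * ι b
ι-* a b = trans (cong (_/ 1) (ℤ.pos-* a b)) (sym (cong₂ _*_ (ι-mkℚ a) (ι-mkℚ b)))

ι-sumToℕ : ∀ n f → ι (sumToℕ n f) ≡ sumTo n (ι ∘ f)
ι-sumToℕ zero    f = refl
ι-sumToℕ (suc n) f = trans (ι-+ (sumToℕ n f) (f (suc n))) (cong (_+ ι (f (suc n))) (ι-sumToℕ n f))

ι-split : ∀ {k m} → k ≤ m → ι m ≡ ι k + ι (m ∸ k)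
ι-split {k} {m} k≤m = trans (cong ι (sym (ℕ.m+[n∸m]≡n k≤m))) (ι-+ k (m ∸ k))

+1/d*ιd≡1 : ∀ d .{{_ : ℕ.NonZero d}} → (+ 1 / d) * ι d ≡ 1ℚ
+1/d*ιd≡1 (suc d) = trans (cong₂ _*_ (ℚ.normalize-coprime (Coprime.1-coprimeTo (suc d))) (ι-mkℚ (suc d)))
                          (ℚ.*-inverseˡ (mkℚ (+ suc d) 0 (Coprime.sym (Coprime.1-coprimeTo (suc d)))))

expˢ*ι!≡1 : ∀ n → expˢ n * ι (n !) ≡ 1ℚ
expˢ*ι!≡1 n = +1/d*ιd≡1 (n !) {{n !≢0}}

inverse-unique : ∀ a b c → a * c ≡ 1ℚ → b * c ≡ 1ℚ → a ≡ b
inverse-unique a b c ac≡1 bc≡1 = begin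
  a            ≡⟨ ℚ.*-identityʳ a ⟨
  a * 1ℚ       ≡⟨ cong (a *_) bc≡1 ⟨
  a * (b * c)  ≡⟨ *ᶜ.x∙yz≈y∙xz a b c ⟩
  b * (a * c)  ≡⟨ cong (b *_) ac≡1 ⟩
  b * 1ℚ       ≡⟨ ℚ.*-identityʳ b ⟩
  b            ∎

ι[1+n]*expˢ[1+n]≡expˢn : ∀ n → ι (suc n) * expˢ (suc n) ≡ expˢ n
ι[1+n]*expˢ[1+n]≡expˢn n = inverse-unique _ _ (ι (n !)) product≡1 (expˢ*ι!≡1 n)
  where
  product≡1 : ι (suc n) * expˢ (suc n) * ι (n !) ≡ 1ℚ
  product≡1 = begin
    ι (suc n) * expˢ (suc n) * ι (n !)   ≡⟨ *ᶜ.xy∙z≈y∙xz (ι (suc n)) (expˢ (suc n)) (ι (n !)) ⟩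
    expˢ (suc n) * (ι (suc n) * ι (n !)) ≡⟨ cong (expˢ (suc n) *_) (ι-* (suc n) (n !)) ⟨
    expˢ (suc n) * ι (suc n !)           ≡⟨ expˢ*ι!≡1 (suc n) ⟩
    1ℚ                                   ∎

sumTo-cong : ∀ n {f g : ℕ → ℚ} → (∀ k → k ≤ n → f k ≡ g k) → sumTo n f ≡ sumTo n g
sumTo-cong zero    f≡g = f≡g 0 z≤n
sumTo-cong (suc n) f≡g =
  cong₂ _+_ (sumTo-cong n (λ k k≤n → f≡g k (ℕ.m≤n⇒m≤1+n k≤n))) (f≡g (suc n) ℕ.≤-refl)

sumTo-cong-≗ : ∀ n {f g : ℕ → ℚ} → f ≗ g → sumTo n f ≡ sumTo n g
sumTo-cong-≗ n f≗g = sumTo-cong n (λ k _ → f≗g k)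

sumTo-zero : ∀ n (f : ℕ → ℚ) → (∀ k → k ≤ n → f k ≡ 0ℚ) → sumTo n f ≡ 0ℚ
sumTo-zero zero    f f≡0 = f≡0 0 z≤n
sumTo-zero (suc n) f f≡0 =
  cong₂ _+_ (sumTo-zero n f (λ k k≤n → f≡0 k (ℕ.m≤n⇒m≤1+n k≤n))) (f≡0 (suc n) ℕ.≤-refl)

sumTo-distrib-+ : ∀ n (f g : ℕ → ℚ) → sumTo n (λ k → f k + g k) ≡ sumTo n f + sumTo n g
sumTo-distrib-+ zero    f g = refl
sumTo-distrib-+ (suc n) f g = trans (cong (_+ (f (suc n) + g (suc n))) (sumTo-distrib-+ n f g))
  (+ᶜ.interchange (sumTo n f) (sumTo n g) (f (suc n)) (g (suc n)))

*-distribˡ-sumTo : ∀ n c (f : ℕ → ℚ) → c * sumTo n f ≡ sumTo n (λ k → c * f k)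
*-distribˡ-sumTo zero    c f = refl
*-distribˡ-sumTo (suc n) c f =
  trans (ℚ.*-distribˡ-+ c (sumTo n f) (f (suc n))) (cong (_+ c * f (suc n)) (*-distribˡ-sumTo n c f))

*-distribʳ-sumTo : ∀ n c (f : ℕ → ℚ) → sumTo n f * c ≡ sumTo n (λ k → f k * c)
*-distribʳ-sumTo n c f = trans (ℚ.*-comm (sumTo n f) c)
  (trans (*-distribˡ-sumTo n c f) (sumTo-cong-≗ n (λ k → ℚ.*-comm c (f k))))

neg-distrib-sumTo : ∀ n (f : ℕ → ℚ) → - sumTo n f ≡ sumTo n (λ k → - f k)
neg-distrib-sumTo zero    f = refl
neg-distrib-sumTo (suc n) f =
  trans (ℚ.neg-distrib-+ (sumTo n f) (f (suc n))) (cong (_+ - f (suc n)) (neg-distrib-sumTo n f))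

sumTo-suc : ∀ n (f : ℕ → ℚ) → sumTo (suc n) f ≡ f 0 + sumTo n (f ∘ suc)
sumTo-suc zero    f = refl
sumTo-suc (suc n) f =
  trans (cong (_+ f (suc (suc n))) (sumTo-suc n f)) (ℚ.+-assoc (f 0) (sumTo n (f ∘ suc)) (f (suc (suc n))))

sumTo-head : ∀ n (f : ℕ → ℚ) → (∀ k → f (suc k) ≡ 0ℚ) → sumTo n f ≡ f 0
sumTo-head zero    f f≡0 = refl
sumTo-head (suc n) f f≡0 = trans (cong₂ _+_ (sumTo-head n f f≡0) (f≡0 n)) (ℚ.+-identityʳ (f 0))

sumTo-last : ∀ n (f : ℕ → ℚ) → (∀ k → k < n → f k ≡ 0ℚ) → sumTo n f ≡ f n
sumTo-last zero    f f≡0 = refl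
sumTo-last (suc n) f f≡0 =
  trans (cong (_+ f (suc n)) (sumTo-zero n f (λ k k≤n → f≡0 k (s≤s k≤n)))) (ℚ.+-identityˡ (f (suc n)))

sumTo-pad : ∀ {n m} (f : ℕ → ℚ) → n ≤ m → (∀ k → n < k → f k ≡ 0ℚ) → sumTo m f ≡ sumTo n f
sumTo-pad {n} {m} f n≤m f≡0 = trans (cong (λ l → sumTo l f) (sym (ℕ.m∸n+n≡m n≤m))) (pad (m ∸ n))
  where
  pad : ∀ d → sumTo (d ℕ.+ n) f ≡ sumTo n f
  pad zero    = refl
  pad (suc d) = trans (cong (λ z → sumTo (d ℕ.+ n) f + z) (f≡0 (suc (d ℕ.+ n)) (s≤s (ℕ.m≤n+m n d))))
                      (trans (ℚ.+-identityʳ _) (pad d))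

sumTo-comm : ∀ n m (f : ℕ → ℕ → ℚ) → sumTo n (λ i → sumTo m (f i)) ≡ sumTo m (λ j → sumTo n (λ i → f i j))
sumTo-comm zero    m f = refl
sumTo-comm (suc n) m f = trans (cong (_+ sumTo m (f (suc n))) (sumTo-comm n m f))
  (sym (sumTo-distrib-+ m (λ j → sumTo n (λ i → f i j)) (f (suc n))))

sumTo-triangle : ∀ n (F : ℕ → ℕ → ℚ) →
  sumTo n (λ a → sumTo a (F a)) ≡ sumTo n (λ i → sumTo (n ∸ i) (λ j → F (i ℕ.+ j) i))
sumTo-triangle zero    F = refl
sumTo-triangle (suc n) F = sym (begin
    sumTo n (λ i → sumTo (suc n ∸ i) (λ j → F (i ℕ.+ j) i)) + sumTo (n ∸ n) (λ j → F (suc n ℕ.+ j) (suc n))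
  ≡⟨ cong₂ _+_ (sumTo-cong n column) corner ⟩
    sumTo n (λ i → sumTo (n ∸ i) (λ j → F (i ℕ.+ j) i) + F (suc n) i) + F (suc n) (suc n)
  ≡⟨ cong (_+ F (suc n) (suc n)) (sumTo-distrib-+ n _ (F (suc n))) ⟩
    sumTo n (λ i → sumTo (n ∸ i) (λ j → F (i ℕ.+ j) i)) + sumTo n (F (suc n)) + F (suc n) (suc n)
  ≡⟨ ℚ.+-assoc (sumTo n (λ i → sumTo (n ∸ i) (λ j → F (i ℕ.+ j) i))) (sumTo n (F (suc n))) (F (suc n) (suc n)) ⟩
    sumTo n (λ i → sumTo (n ∸ i) (λ j → F (i ℕ.+ j) i)) + sumTo (suc n) (F (suc n))
  ≡⟨ cong (_+ sumTo (suc n) (F (suc n))) (sumTo-triangle n F) ⟨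
    sumTo n (λ a → sumTo a (F a)) + sumTo (suc n) (F (suc n))
  ∎)
  where
  corner : sumTo (n ∸ n) (λ j → F (suc n ℕ.+ j) (suc n)) ≡ F (suc n) (suc n)
  corner rewrite ℕ.n∸n≡0 n | ℕ.+-identityʳ n = refl
  column : ∀ i → i ≤ n →
    sumTo (suc n ∸ i) (λ j → F (i ℕ.+ j) i) ≡ sumTo (n ∸ i) (λ j → F (i ℕ.+ j) i) + F (suc n) i
  column i i≤n rewrite ℕ.+-∸-assoc 1 i≤n =
    cong (λ l → sumTo (n ∸ i) (λ j → F (i ℕ.+ j) i) + F l i)
         (trans (ℕ.+-suc i (n ∸ i)) (cong suc (ℕ.m+[n∸m]≡n i≤n)))

-- Formal power series

1ˢ : PS
1ˢ zero    = 1ℚ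
1ˢ (suc _) = 0ℚ

_+ˢ_ : PS → PS → PS
(f +ˢ g) n = f n + g n

^ˢ-zero : ∀ f → (f ^ˢ 0) ≗ 1ˢ
^ˢ-zero f zero    = refl
^ˢ-zero f (suc n) = refl

⊛-cong : ∀ {f f′ g g′} → f ≗ f′ → g ≗ g′ → (f ⊛ g) ≗ (f′ ⊛ g′)
⊛-cong f≗f′ g≗g′ n = sumTo-cong-≗ n (λ k → cong₂ _*_ (f≗f′ k) (g≗g′ (n ∸ k)))

⊛-congˡ : ∀ f {g g′} → g ≗ g′ → (f ⊛ g) ≗ (f ⊛ g′)
⊛-congˡ f = ⊛-cong {f} {f} (λ _ → refl)

⊛-congʳ : ∀ {f f′} g → f ≗ f′ → (f ⊛ g) ≗ (f′ ⊛ g)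
⊛-congʳ {f} {f′} g f≗f′ = ⊛-cong {f} {f′} {g} {g} f≗f′ (λ _ → refl)

⊛-identityˡ : ∀ f → (1ˢ ⊛ f) ≗ f
⊛-identityˡ f n = trans (sumTo-head n _ (λ k → ℚ.*-zeroˡ (f (n ∸ suc k)))) (ℚ.*-identityˡ (f n))

⊛-identityʳ : ∀ f → (f ⊛ 1ˢ) ≗ f
⊛-identityʳ f n =
  trans (sumTo-last n _ off-diagonal) (trans (cong (λ l → f n * 1ˢ l) (ℕ.n∸n≡0 n)) (ℚ.*-identityʳ (f n)))
  where
  off-diagonal : ∀ k → k < n → f k * 1ˢ (n ∸ k) ≡ 0ℚ
  off-diagonal k k<n rewrite ℕ.+-∸-assoc 1 k<n = ℚ.*-zeroʳ (f k)

⊛-assoc : ∀ f g h → ((f ⊛ g) ⊛ h) ≗ (f ⊛ (g ⊛ h))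
⊛-assoc f g h n = begin
    sumTo n (λ a → sumTo a (λ i → f i * g (a ∸ i)) * h (n ∸ a))
  ≡⟨ sumTo-cong-≗ n (λ a → *-distribʳ-sumTo a (h (n ∸ a)) _) ⟩
    sumTo n (λ a → sumTo a (λ i → f i * g (a ∸ i) * h (n ∸ a)))
  ≡⟨ sumTo-triangle n (λ a i → f i * g (a ∸ i) * h (n ∸ a)) ⟩
    sumTo n (λ i → sumTo (n ∸ i) (λ j → f i * g ((i ℕ.+ j) ∸ i) * h (n ∸ (i ℕ.+ j))))
  ≡⟨ sumTo-cong-≗ n (λ i → sumTo-cong-≗ (n ∸ i) (λ j →
       trans (cong₂ (λ u v → f i * g u * h v) (ℕ.m+n∸m≡n i j) (sym (ℕ.∸-+-assoc n i j)))
             (ℚ.*-assoc (f i) (g j) (h (n ∸ i ∸ j))))) ⟩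
    sumTo n (λ i → sumTo (n ∸ i) (λ j → f i * (g j * h (n ∸ i ∸ j))))
  ≡⟨ sumTo-cong-≗ n (λ i → *-distribˡ-sumTo (n ∸ i) (f i) _) ⟨
    sumTo n (λ i → f i * sumTo (n ∸ i) (λ j → g j * h (n ∸ i ∸ j)))
  ∎

⊛-distribˡ-+ˢ : ∀ f g h → (f ⊛ (g +ˢ h)) ≗ ((f ⊛ g) +ˢ (f ⊛ h))
⊛-distribˡ-+ˢ f g h n =
  trans (sumTo-cong-≗ n (λ k → ℚ.*-distribˡ-+ (f k) (g (n ∸ k)) (h (n ∸ k)))) (sumTo-distrib-+ n _ _)

⊛-distribʳ-+ˢ : ∀ f g h → ((f +ˢ g) ⊛ h) ≗ ((f ⊛ h) +ˢ (g ⊛ h))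
⊛-distribʳ-+ˢ f g h n =
  trans (sumTo-cong-≗ n (λ k → ℚ.*-distribʳ-+ (h (n ∸ k)) (f k) (g k))) (sumTo-distrib-+ n _ _)

⊛-scaleˡ : ∀ c f g → ((c ·ˢ f) ⊛ g) ≗ (c ·ˢ (f ⊛ g))
⊛-scaleˡ c f g n = trans (sumTo-cong-≗ n (λ k → ℚ.*-assoc c (f k) (g (n ∸ k)))) (sym (*-distribˡ-sumTo n c _))

⊛-scaleʳ : ∀ f c g → (f ⊛ (c ·ˢ g)) ≗ (c ·ˢ (f ⊛ g))
⊛-scaleʳ f c g n =
  trans (sumTo-cong-≗ n (λ k → *ᶜ.x∙yz≈y∙xz (f k) c (g (n ∸ k)))) (sym (*-distribˡ-sumTo n c _))

^ˢ-+ : ∀ g i j → ((g ^ˢ i) ⊛ (g ^ˢ j)) ≗ (g ^ˢ (i ℕ.+ j))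
^ˢ-+ g zero    j n = trans (⊛-congʳ (g ^ˢ j) (^ˢ-zero g) n) (⊛-identityˡ (g ^ˢ j) n)
^ˢ-+ g (suc i) j n = trans (⊛-assoc g (g ^ˢ i) (g ^ˢ j) n) (⊛-congˡ g (^ˢ-+ g i j) n)

·ˢ-^ˢ : ∀ c f k → ((c ·ˢ f) ^ˢ k) ≗ ((c ^q k) ·ˢ (f ^ˢ k))
·ˢ-^ˢ c f zero    n = trans (^ˢ-zero (c ·ˢ f) n) (sym (trans (ℚ.*-identityˡ ((f ^ˢ 0) n)) (^ˢ-zero f n)))
·ˢ-^ˢ c f (suc k) n = begin
    ((c ·ˢ f) ⊛ ((c ·ˢ f) ^ˢ k)) n       ≡⟨ ⊛-congˡ (c ·ˢ f) (·ˢ-^ˢ c f k) n ⟩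
    ((c ·ˢ f) ⊛ ((c ^q k) ·ˢ (f ^ˢ k))) n ≡⟨ ⊛-scaleʳ (c ·ˢ f) (c ^q k) (f ^ˢ k) n ⟩
    (c ^q k) * ((c ·ˢ f) ⊛ (f ^ˢ k)) n    ≡⟨ cong ((c ^q k) *_) (⊛-scaleˡ c f (f ^ˢ k) n) ⟩
    (c ^q k) * (c * (f ⊛ (f ^ˢ k)) n)     ≡⟨ *ᶜ.x∙yz≈yx∙z (c ^q k) c ((f ⊛ (f ^ˢ k)) n) ⟩
    c * (c ^q k) * (f ⊛ (f ^ˢ k)) n       ∎

^ˢ-vanishes-below : ∀ g → g 0 ≡ 0ℚ → ∀ k n → n < k → (g ^ˢ k) n ≡ 0ℚ
^ˢ-vanishes-below g g₀≡0 (suc k) n n<1+k = sumTo-zero n _ term≡0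
  where
  term≡0 : ∀ i → i ≤ n → g i * (g ^ˢ k) (n ∸ i) ≡ 0ℚ
  term≡0 zero    _     = x≡0⇒x*y≡0 ((g ^ˢ k) n) g₀≡0
  term≡0 (suc i) 1+i≤n = y≡0⇒x*y≡0 (g (suc i)) (^ˢ-vanishes-below g g₀≡0 k (n ∸ suc i) n∸[1+i]<k)
    where
    n∸[1+i]<k : n ∸ suc i < k
    n∸[1+i]<k = ℕ.<-≤-trans (ℕ.∸-monoʳ-< {n} {suc i} {0} (s≤s z≤n) 1+i≤n) (ℕ.≤-pred n<1+k)

module _ (g : PS) (g₀≡0 : g 0 ≡ 0ℚ) where

  private
    G : ℕ → PS
    G k = g ^ˢ k

  ∘ˢ-pad : ∀ f {n N} → n ≤ N → sumTo N (λ k → f k * G k n) ≡ (f ∘ˢ g) n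
  ∘ˢ-pad f {n} n≤N = sumTo-pad _ n≤N (λ k n<k → y≡0⇒x*y≡0 (f k) (^ˢ-vanishes-below g g₀≡0 k n n<k))

  ⊛-∘ˢ-as-double-sum : ∀ f h n →
    ((f ⊛ h) ∘ˢ g) n ≡ sumTo n (λ i → sumTo n (λ j → f i * h j * G (i ℕ.+ j) n))
  ⊛-∘ˢ-as-double-sum f h n = begin
      sumTo n (λ c → sumTo c (λ i → f i * h (c ∸ i)) * G c n)
    ≡⟨ sumTo-cong-≗ n (λ c → *-distribʳ-sumTo c (G c n) _) ⟩
      sumTo n (λ c → sumTo c (λ i → f i * h (c ∸ i) * G c n))
    ≡⟨ sumTo-triangle n (λ c i → f i * h (c ∸ i) * G c n) ⟩
      sumTo n (λ i → sumTo (n ∸ i) (λ j → f i * h (i ℕ.+ j ∸ i) * G (i ℕ.+ j) n))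
    ≡⟨ sumTo-cong n (λ i i≤n →
         trans (sumTo-cong-≗ (n ∸ i) (λ j → cong (λ l → f i * h l * G (i ℕ.+ j) n) (ℕ.m+n∸m≡n i j)))
               (sym (sumTo-pad _ (ℕ.m∸n≤m n i) (beyond i i≤n)))) ⟩
      sumTo n (λ i → sumTo n (λ j → f i * h j * G (i ℕ.+ j) n))
    ∎
    where
    beyond : ∀ i → i ≤ n → ∀ j → n ∸ i < j → f i * h j * G (i ℕ.+ j) n ≡ 0ℚ
    beyond i i≤n j n∸i<j =
      y≡0⇒x*y≡0 (f i * h j) (^ˢ-vanishes-below g g₀≡0 (i ℕ.+ j) n n<i+j)
      where
      n<i+j : n < i ℕ.+ j
      n<i+j = subst (_< i ℕ.+ j) (ℕ.m+[n∸m]≡n i≤n) (ℕ.+-monoʳ-< i n∸i<j)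

  ∘ˢ-⊛-∘ˢ-as-double-sum : ∀ f h n →
    ((f ∘ˢ g) ⊛ (h ∘ˢ g)) n ≡ sumTo n (λ i → sumTo n (λ j → f i * h j * G (i ℕ.+ j) n))
  ∘ˢ-⊛-∘ˢ-as-double-sum f h n = begin
      sumTo n (λ a → (f ∘ˢ g) a * (h ∘ˢ g) (n ∸ a))
    ≡⟨ sumTo-cong n (λ a a≤n → sym (cong₂ _*_ (∘ˢ-pad f a≤n) (∘ˢ-pad h (ℕ.m∸n≤m n a)))) ⟩
      sumTo n (λ a → sumTo n (λ i → f i * G i a) * sumTo n (λ j → h j * G j (n ∸ a)))
    ≡⟨ sumTo-cong-≗ n (λ a → trans (*-distribʳ-sumTo n _ _)
                                   (sumTo-cong-≗ n (λ i → *-distribˡ-sumTo n (f i * G i a) _))) ⟩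
      sumTo n (λ a → sumTo n (λ i → sumTo n (λ j → f i * G i a * (h j * G j (n ∸ a)))))
    ≡⟨ sumTo-comm n n _ ⟩
      sumTo n (λ i → sumTo n (λ a → sumTo n (λ j → f i * G i a * (h j * G j (n ∸ a)))))
    ≡⟨ sumTo-cong-≗ n (λ i → sumTo-comm n n _) ⟩
      sumTo n (λ i → sumTo n (λ j → sumTo n (λ a → f i * G i a * (h j * G j (n ∸ a)))))
    ≡⟨ sumTo-cong-≗ n (λ i → sumTo-cong-≗ n (λ j → trans
         (sumTo-cong-≗ n (λ a → *ᶜ.interchange (f i) (G i a) (h j) (G j (n ∸ a))))
         (sym (*-distribˡ-sumTo n (f i * h j) _)))) ⟩
      sumTo n (λ i → sumTo n (λ j → f i * h j * ((G i ⊛ G j) n)))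
    ≡⟨ sumTo-cong-≗ n (λ i → sumTo-cong-≗ n (λ j → cong (f i * h j *_) (^ˢ-+ g i j n))) ⟩
      sumTo n (λ i → sumTo n (λ j → f i * h j * G (i ℕ.+ j) n))
    ∎

  ∘ˢ-⊛ : ∀ f h → ((f ⊛ h) ∘ˢ g) ≗ ((f ∘ˢ g) ⊛ (h ∘ˢ g))
  ∘ˢ-⊛ f h n = trans (⊛-∘ˢ-as-double-sum f h n) (sym (∘ˢ-⊛-∘ˢ-as-double-sum f h n))

  ∘ˢ-^ˢ : ∀ f k → ((f ∘ˢ g) ^ˢ k) ≗ ((f ^ˢ k) ∘ˢ g)
  ∘ˢ-^ˢ f zero    n = begin
    ((f ∘ˢ g) ^ˢ 0) n                   ≡⟨ ^ˢ-zero (f ∘ˢ g) n ⟩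
    1ˢ n                                ≡⟨ ^ˢ-zero g n ⟨
    G 0 n                               ≡⟨ ℚ.*-identityˡ (G 0 n) ⟨
    (f ^ˢ 0) 0 * G 0 n                  ≡⟨ sumTo-head n _ (λ k → ℚ.*-zeroˡ (G (suc k) n)) ⟨
    sumTo n (λ k → (f ^ˢ 0) k * G k n)  ∎
  ∘ˢ-^ˢ f (suc k) n = trans (⊛-congˡ (f ∘ˢ g) (∘ˢ-^ˢ f k) n) (sym (∘ˢ-⊛ f (f ^ˢ k) n))

D : PS → PS
D f n = ι (suc n) * f (suc n)

D-cong : ∀ {f g} → f ≗ g → D f ≗ D g
D-cong f≗g n = cong (ι (suc n) *_) (f≗g (suc n))

D-⊛ : ∀ f g → D (f ⊛ g) ≗ ((D f ⊛ g) +ˢ (f ⊛ D g))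
D-⊛ f g n = begin
    ι (suc n) * sumTo (suc n) (λ k → f k * g (suc n ∸ k))
  ≡⟨ *-distribˡ-sumTo (suc n) (ι (suc n)) _ ⟩
    sumTo (suc n) (λ k → ι (suc n) * (f k * g (suc n ∸ k)))
  ≡⟨ sumTo-cong (suc n) split ⟩
    sumTo (suc n) (λ k → L k + R k)
  ≡⟨ sumTo-distrib-+ (suc n) L R ⟩
    sumTo (suc n) L + sumTo (suc n) R
  ≡⟨ cong₂ _+_ ΣL≡Df⊛g ΣR≡f⊛Dg ⟩
    (D f ⊛ g) n + (f ⊛ D g) n
  ∎
  where
  L R : ℕ → ℚ
  L k = ι k * f k * g (suc n ∸ k)
  R k = f k * (ι (suc n ∸ k) * g (suc n ∸ k))
  split : ∀ k → k ≤ suc n → ι (suc n) * (f k * g (suc n ∸ k)) ≡ L k + R k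
  split k k≤1+n = begin
    ι (suc n) * (f k * g (suc n ∸ k))
      ≡⟨ cong (_* (f k * g (suc n ∸ k))) (ι-split k≤1+n) ⟩
    (ι k + ι (suc n ∸ k)) * (f k * g (suc n ∸ k))
      ≡⟨ ℚ.*-distribʳ-+ (f k * g (suc n ∸ k)) (ι k) (ι (suc n ∸ k)) ⟩
    ι k * (f k * g (suc n ∸ k)) + ι (suc n ∸ k) * (f k * g (suc n ∸ k))
      ≡⟨ cong₂ _+_ (sym (ℚ.*-assoc (ι k) (f k) _)) (*ᶜ.x∙yz≈y∙xz (ι (suc n ∸ k)) (f k) _) ⟩
    L k + R k ∎
  ΣL≡Df⊛g : sumTo (suc n) L ≡ (D f ⊛ g) n
  ΣL≡Df⊛g = begin
    sumTo (suc n) L            ≡⟨ sumTo-suc n L ⟩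
    L 0 + sumTo n (L ∘ suc)    ≡⟨ cong (_+ sumTo n (L ∘ suc)) (x≡0⇒x*y≡0 (g (suc n)) (ℚ.*-zeroˡ (f 0))) ⟩
    0ℚ + sumTo n (L ∘ suc)     ≡⟨ ℚ.+-identityˡ (sumTo n (L ∘ suc)) ⟩
    (D f ⊛ g) n                ∎
  Rₙ₊₁≡0 : R (suc n) ≡ 0ℚ
  Rₙ₊₁≡0 rewrite ℕ.n∸n≡0 n = y≡0⇒x*y≡0 (f (suc n)) (ℚ.*-zeroˡ (g 0))
  Rₖ≡f*Dg : ∀ k → k ≤ n → R k ≡ f k * D g (n ∸ k)
  Rₖ≡f*Dg k k≤n rewrite ℕ.+-∸-assoc 1 k≤n = refl
  ΣR≡f⊛Dg : sumTo (suc n) R ≡ (f ⊛ D g) n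
  ΣR≡f⊛Dg = begin
    sumTo n R + R (suc n)      ≡⟨ cong (_+_ (sumTo n R)) Rₙ₊₁≡0 ⟩
    sumTo n R + 0ℚ             ≡⟨ ℚ.+-identityʳ (sumTo n R) ⟩
    sumTo n R                  ≡⟨ sumTo-cong n Rₖ≡f*Dg ⟩
    (f ⊛ D g) n                ∎

D-expm1 : D expm1 ≗ (expm1 +ˢ 1ˢ)
D-expm1 zero    = refl
D-expm1 (suc n) = trans (ι[1+n]*expˢ[1+n]≡expˢn (suc n)) (sym (ℚ.+-identityʳ _))

D-expm1^ˢ : ∀ j → D (expm1 ^ˢ suc j) ≗ (ι (suc j) ·ˢ ((expm1 ^ˢ suc j) +ˢ (expm1 ^ˢ j)))
D-expm1^ˢ zero n = begin
    D (E ⊛ (E ^ˢ 0)) n                     ≡⟨ D-cong E¹≗E n ⟩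
    D E n                                  ≡⟨ D-expm1 n ⟩
    E n + 1ˢ n                             ≡⟨ cong₂ _+_ (E¹≗E n) (^ˢ-zero E n) ⟨
    (E ⊛ (E ^ˢ 0)) n + (E ^ˢ 0) n          ≡⟨ ℚ.*-identityˡ _ ⟨
    ι 1 * ((E ⊛ (E ^ˢ 0)) n + (E ^ˢ 0) n)  ∎
  where
  E = expm1
  E¹≗E : (E ⊛ (E ^ˢ 0)) ≗ E
  E¹≗E m = trans (⊛-congˡ E (^ˢ-zero E) m) (⊛-identityʳ E m)
D-expm1^ˢ (suc j) n = begin
    D (E ⊛ Eʲ⁺¹) n
  ≡⟨ D-⊛ E Eʲ⁺¹ n ⟩
    (D E ⊛ Eʲ⁺¹) n + (E ⊛ D Eʲ⁺¹) n
  ≡⟨ cong₂ _+_ (trans (⊛-congʳ Eʲ⁺¹ D-expm1 n)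
                  (trans (⊛-distribʳ-+ˢ E 1ˢ Eʲ⁺¹ n) (cong (_+_ ((E ⊛ Eʲ⁺¹) n)) (⊛-identityˡ Eʲ⁺¹ n))))
               (trans (⊛-congˡ E (D-expm1^ˢ j) n)
                  (trans (⊛-scaleʳ E c (Eʲ⁺¹ +ˢ Eʲ) n) (cong (c *_) (⊛-distribˡ-+ˢ E Eʲ⁺¹ Eʲ n)))) ⟩
    (Eʲ⁺² n + Eʲ⁺¹ n) + c * (Eʲ⁺² n + Eʲ⁺¹ n)
  ≡⟨ cong (_+ c * (Eʲ⁺² n + Eʲ⁺¹ n)) (ℚ.*-identityˡ (Eʲ⁺² n + Eʲ⁺¹ n)) ⟨
    1ℚ * (Eʲ⁺² n + Eʲ⁺¹ n) + c * (Eʲ⁺² n + Eʲ⁺¹ n)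
  ≡⟨ ℚ.*-distribʳ-+ (Eʲ⁺² n + Eʲ⁺¹ n) 1ℚ c ⟨
    (1ℚ + c) * (Eʲ⁺² n + Eʲ⁺¹ n)
  ≡⟨ cong (_* (Eʲ⁺² n + Eʲ⁺¹ n)) (ι-+ 1 (suc j)) ⟨
    ι (suc (suc j)) * (Eʲ⁺² n + Eʲ⁺¹ n)
  ∎
  where
  E = expm1
  Eʲ = E ^ˢ j
  Eʲ⁺¹ = E ^ˢ suc j
  Eʲ⁺² = E ^ˢ suc (suc j)
  c = ι (suc j)

-- Stirling numbers from powers of e^t − 1

!*S-suc : ∀ n k →
  ι (suc k) * (ι (suc k !) * ι (S n (suc k)) + ι (k !) * ι (S n k)) ≡ ι (suc k !) * ι (S (suc n) (suc k))
!*S-suc n k = begin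
    ι (suc k) * (ι (suc k !) * ι (S n (suc k)) + ι (k !) * ι (S n k))
  ≡⟨ cong (ι (suc k) *_) (cong₂ _+_ (ι-* (suc k !) (S n (suc k))) (ι-* (k !) (S n k))) ⟨
    ι (suc k) * (ι (suc k ! ℕ.* S n (suc k)) + ι (k ! ℕ.* S n k))
  ≡⟨ trans (ι-* (suc k) (suc k ! ℕ.* S n (suc k) ℕ.+ k ! ℕ.* S n k))
           (cong (ι (suc k) *_) (ι-+ (suc k ! ℕ.* S n (suc k)) (k ! ℕ.* S n k))) ⟨
    ι (suc k ℕ.* (suc k ! ℕ.* S n (suc k) ℕ.+ k ! ℕ.* S n k))
  ≡⟨ cong ι (ℕS.solve 4 (λ a f s₁ s₀ → a :* (a :* f :* s₁ :+ f :* s₀) := a :* f :* (a :* s₁ :+ s₀)) refl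
               (suc k) (k !) (S n (suc k)) (S n k)) ⟩
    ι (suc k ! ℕ.* S (suc n) (suc k))
  ≡⟨ ι-* (suc k !) (S (suc n) (suc k)) ⟩
    ι (suc k !) * ι (S (suc n) (suc k))
  ∎
  where open ℕS using (_:*_; _:+_; _:=_)

expm1^ˢ-coeff : ∀ n k → ι (n !) * (expm1 ^ˢ k) n ≡ ι (k !) * ι (S n k)
expm1^ˢ-coeff zero    zero    = refl
expm1^ˢ-coeff zero    (suc k) =
  trans (y≡0⇒x*y≡0 (ι 1) (ℚ.*-zeroˡ ((expm1 ^ˢ k) 0))) (sym (ℚ.*-zeroʳ (ι (suc k !))))
expm1^ˢ-coeff (suc n) zero    = trans (ℚ.*-zeroʳ (ι (suc n !))) (sym (ℚ.*-zeroʳ (ι 1)))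
expm1^ˢ-coeff (suc n) (suc k) = begin
    ι (suc n !) * Eᵏ⁺¹ (suc n)
  ≡⟨ cong (_* Eᵏ⁺¹ (suc n)) (ι-* (suc n) (n !)) ⟩
    ι (suc n) * ι (n !) * Eᵏ⁺¹ (suc n)
  ≡⟨ *ᶜ.xy∙z≈y∙xz (ι (suc n)) (ι (n !)) (Eᵏ⁺¹ (suc n)) ⟩
    ι (n !) * D Eᵏ⁺¹ n
  ≡⟨ cong (ι (n !) *_) (D-expm1^ˢ k n) ⟩
    ι (n !) * (ι (suc k) * (Eᵏ⁺¹ n + Eᵏ n))
  ≡⟨ trans (*ᶜ.x∙yz≈y∙xz (ι (n !)) (ι (suc k)) (Eᵏ⁺¹ n + Eᵏ n))
           (cong (ι (suc k) *_) (ℚ.*-distribˡ-+ (ι (n !)) (Eᵏ⁺¹ n) (Eᵏ n))) ⟩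
    ι (suc k) * (ι (n !) * Eᵏ⁺¹ n + ι (n !) * Eᵏ n)
  ≡⟨ cong (ι (suc k) *_) (cong₂ _+_ (expm1^ˢ-coeff n (suc k)) (expm1^ˢ-coeff n k)) ⟩
    ι (suc k) * (ι (suc k !) * ι (S n (suc k)) + ι (k !) * ι (S n k))
  ≡⟨ !*S-suc n k ⟩
    ι (suc k !) * ι (S (suc n) (suc k))
  ∎
  where
  Eᵏ = expm1 ^ˢ k
  Eᵏ⁺¹ = expm1 ^ˢ suc k

ι-Sᵖ-suc : ∀ p n m → ι (Sᵖ (suc p) n m) ≡ sumTo n (λ k → ι (S n k) * ι (Sᵖ p k m))
ι-Sᵖ-suc p n m = trans (ι-sumToℕ n _) (sumTo-cong-≗ n (λ k → ι-* (S n k) (Sᵖ p k m)))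

tˢ-⊛ : ∀ f n → (tˢ ⊛ f) (suc n) ≡ f n
tˢ-⊛ f n = begin
    (tˢ ⊛ f) (suc n)
  ≡⟨ sumTo-suc n _ ⟩
    tˢ 0 * f (suc n) + sumTo n (λ i → tˢ (suc i) * f (n ∸ i))
  ≡⟨ cong₂ _+_ (ℚ.*-zeroˡ (f (suc n))) (sumTo-head n _ (λ i → ℚ.*-zeroˡ (f (n ∸ suc i)))) ⟩
    0ℚ + 1ℚ * f n
  ≡⟨ trans (ℚ.+-identityˡ (1ℚ * f n)) (ℚ.*-identityˡ (f n)) ⟩
    f n
  ∎

tˢ^ˢ-coeff : ∀ k n → (tˢ ^ˢ k) n ≡ ι (δ n k)
tˢ^ˢ-coeff zero    zero    = refl
tˢ^ˢ-coeff zero    (suc n) = refl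
tˢ^ˢ-coeff (suc k) zero    = ℚ.*-zeroˡ ((tˢ ^ˢ k) 0)
tˢ^ˢ-coeff (suc k) (suc n) = trans (tˢ-⊛ (tˢ ^ˢ k) n) (tˢ^ˢ-coeff k n)

δ-subst : ∀ n k (f : ℕ → ℚ) → f n * ι (δ n k) ≡ f k * ι (δ n k)
δ-subst zero    zero    f = refl
δ-subst zero    (suc k) f = trans (ℚ.*-zeroʳ (f 0)) (sym (ℚ.*-zeroʳ (f (suc k))))
δ-subst (suc n) zero    f = trans (ℚ.*-zeroʳ (f (suc n))) (sym (ℚ.*-zeroʳ (f 0)))
δ-subst (suc n) (suc k) f = δ-subst n k (f ∘ suc)

σ^ˢ-coeff : ∀ p n k → ι (n !) * (σ p ^ˢ k) n ≡ ι (k !) * ι (Sᵖ p n k)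
σ^ˢ-coeff zero    n k = trans (cong (ι (n !) *_) (tˢ^ˢ-coeff k n)) (δ-subst n k (λ i → ι (i !)))
σ^ˢ-coeff (suc p) n k = begin
    ι (n !) * ((σ p ∘ˢ expm1) ^ˢ k) n
  ≡⟨ cong (ι (n !) *_) (∘ˢ-^ˢ expm1 refl (σ p) k n) ⟩
    ι (n !) * sumTo n (λ j → σᵏ j * (expm1 ^ˢ j) n)
  ≡⟨ *-distribˡ-sumTo n (ι (n !)) _ ⟩
    sumTo n (λ j → ι (n !) * (σᵏ j * (expm1 ^ˢ j) n))
  ≡⟨ sumTo-cong-≗ n (λ j → trans (*ᶜ.x∙yz≈y∙xz (ι (n !)) (σᵏ j) ((expm1 ^ˢ j) n))
                                 (cong (σᵏ j *_) (expm1^ˢ-coeff n j))) ⟩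
    sumTo n (λ j → σᵏ j * (ι (j !) * ι (S n j)))
  ≡⟨ sumTo-cong-≗ n (λ j → trans (*ᶜ.x∙yz≈yx∙z (σᵏ j) (ι (j !)) (ι (S n j)))
                                 (cong (_* ι (S n j)) (σ^ˢ-coeff p j k))) ⟩
    sumTo n (λ j → ι (k !) * ι (Sᵖ p j k) * ι (S n j))
  ≡⟨ sumTo-cong-≗ n (λ j → *ᶜ.xy∙z≈x∙zy (ι (k !)) (ι (Sᵖ p j k)) (ι (S n j))) ⟩
    sumTo n (λ j → ι (k !) * (ι (S n j) * ι (Sᵖ p j k)))
  ≡⟨ *-distribˡ-sumTo n (ι (k !)) _ ⟨
    ι (k !) * sumTo n (λ j → ι (S n j) * ι (Sᵖ p j k))
  ≡⟨ cong (ι (k !) *_) (ι-Sᵖ-suc p n k) ⟨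
    ι (k !) * ι (Sᵖ (suc p) n k)
  ∎
  where
  σᵏ = σ p ^ˢ k

Bell-expansion : ∀ p n x → B p n x ≡ sumTo n (λ m → ι (Sᵖ p n m) * (x ^q m))
Bell-expansion p n x = begin
    ι (n !) * sumTo n (λ k → expˢ k * ((x ·ˢ σ p) ^ˢ k) n)
  ≡⟨ *-distribˡ-sumTo n (ι (n !)) _ ⟩
    sumTo n (λ k → ι (n !) * (expˢ k * ((x ·ˢ σ p) ^ˢ k) n))
  ≡⟨ sumTo-cong-≗ n (λ k → cong (λ c → ι (n !) * (expˢ k * c)) (·ˢ-^ˢ x (σ p) k n)) ⟩
    sumTo n (λ k → ι (n !) * (expˢ k * ((x ^q k) * (σ p ^ˢ k) n)))
  ≡⟨ sumTo-cong-≗ n (λ k → solve 4 (λ a e y s → a :* (e :* (y :* s)) := e :* y :* (a :* s)) refl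
                                   (ι (n !)) (expˢ k) (x ^q k) ((σ p ^ˢ k) n)) ⟩
    sumTo n (λ k → expˢ k * (x ^q k) * (ι (n !) * (σ p ^ˢ k) n))
  ≡⟨ sumTo-cong-≗ n (λ k → cong (expˢ k * (x ^q k) *_) (σ^ˢ-coeff p n k)) ⟩
    sumTo n (λ k → expˢ k * (x ^q k) * (ι (k !) * ι (Sᵖ p n k)))
  ≡⟨ sumTo-cong-≗ n (λ k → trans (solve 4 (λ e y f s → e :* y :* (f :* s) := (e :* f) :* (s :* y)) refl
                                          (expˢ k) (x ^q k) (ι (k !)) (ι (Sᵖ p n k)))
                                 (trans (cong (_* (ι (Sᵖ p n k) * (x ^q k))) (expˢ*ι!≡1 k)) (ℚ.*-identityˡ _))) ⟩
    sumTo n (λ m → ι (Sᵖ p n m) * (x ^q m))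
  ∎
  where open ℚS

-- Forward differences

Δⁿ : ℕ → (ℕ → ℚ) → ℚ
Δⁿ m f = sumTo m (λ k → ι (m C k) * sign (m ∸ k) * f k)

Δⁿ-sumTo : ∀ m n (a : ℕ → ℚ) (g : ℕ → ℕ → ℚ) →
  Δⁿ m (λ k → sumTo n (λ j → a j * g j k)) ≡ sumTo n (λ j → a j * Δⁿ m (g j))
Δⁿ-sumTo m n a g = begin
    sumTo m (λ k → c k * sumTo n (λ j → a j * g j k))
  ≡⟨ sumTo-cong-≗ m (λ k → trans (*-distribˡ-sumTo n (c k) _)
                                 (sumTo-cong-≗ n (λ j → *ᶜ.x∙yz≈y∙xz (c k) (a j) (g j k)))) ⟩
    sumTo m (λ k → sumTo n (λ j → a j * (c k * g j k)))
  ≡⟨ sumTo-comm m n _ ⟩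
    sumTo n (λ j → sumTo m (λ k → a j * (c k * g j k)))
  ≡⟨ sumTo-cong-≗ n (λ j → *-distribˡ-sumTo m (a j) _) ⟨
    sumTo n (λ j → a j * Δⁿ m (g j))
  ∎
  where
  c : ℕ → ℚ
  c k = ι (m C k) * sign (m ∸ k)

sign-suc∸ : ∀ {k m} → k ≤ m → sign (suc m ∸ k) ≡ - sign (m ∸ k)
sign-suc∸ k≤m rewrite ℕ.+-∸-assoc 1 k≤m = refl

Δⁿ-sign-flip : ∀ m f → sumTo (suc m) (λ k → ι (m C k) * sign (suc m ∸ k) * f k) ≡ - Δⁿ m f
Δⁿ-sign-flip m f = begin
    sumTo m T + T (suc m)
  ≡⟨ cong₂ _+_ (sumTo-cong m flip) top≡0 ⟩
    sumTo m (λ k → - (ι (m C k) * sign (m ∸ k) * f k)) + 0ℚ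
  ≡⟨ ℚ.+-identityʳ _ ⟩
    sumTo m (λ k → - (ι (m C k) * sign (m ∸ k) * f k))
  ≡⟨ neg-distrib-sumTo m _ ⟨
    - Δⁿ m f
  ∎
  where
  T : ℕ → ℚ
  T k = ι (m C k) * sign (suc m ∸ k) * f k
  top≡0 : T (suc m) ≡ 0ℚ
  top≡0 rewrite k>n⇒nCk≡0 (ℕ.n<1+n m) = x≡0⇒x*y≡0 (f (suc m)) (ℚ.*-zeroˡ (sign (m ∸ m)))
  flip : ∀ k → k ≤ m → T k ≡ - (ι (m C k) * sign (m ∸ k) * f k)
  flip k k≤m = begin
    ι (m C k) * sign (suc m ∸ k) * f k   ≡⟨ cong (λ s → ι (m C k) * s * f k) (sign-suc∸ k≤m) ⟩
    ι (m C k) * - sign (m ∸ k) * f k     ≡⟨ cong (_* f k) (ℚ.neg-distribʳ-* (ι (m C k)) (sign (m ∸ k))) ⟨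
    - (ι (m C k) * sign (m ∸ k)) * f k   ≡⟨ ℚ.neg-distribˡ-* (ι (m C k) * sign (m ∸ k)) (f k) ⟨
    - (ι (m C k) * sign (m ∸ k) * f k)   ∎

Δⁿ-suc : ∀ m f → Δⁿ (suc m) f ≡ Δⁿ m (f ∘ suc) - Δⁿ m f
Δⁿ-suc m f = begin
    Δⁿ (suc m) f
  ≡⟨ sumTo-suc m _ ⟩
    T₀ + sumTo m (λ k → ι (suc m C suc k) * sign (m ∸ k) * f (suc k))
  ≡⟨ cong (_+_ T₀) (trans (sumTo-cong-≗ m pascal) (sumTo-distrib-+ m _ _)) ⟩
    T₀ + (Δⁿ m (f ∘ suc) + sumTo m (λ k → ι (m C suc k) * sign (m ∸ k) * f (suc k)))
  ≡⟨ +ᶜ.x∙yz≈y∙xz T₀ (Δⁿ m (f ∘ suc)) _ ⟩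
    Δⁿ m (f ∘ suc) + (T₀ + sumTo m (λ k → ι (m C suc k) * sign (m ∸ k) * f (suc k)))
  ≡⟨ cong (_+_ (Δⁿ m (f ∘ suc))) (trans (sym (sumTo-suc m _)) (Δⁿ-sign-flip m f)) ⟩
    Δⁿ m (f ∘ suc) - Δⁿ m f
  ∎
  where
  T₀ : ℚ
  T₀ = ι (m C 0) * sign (suc m) * f 0
  pascal : ∀ k → ι (suc m C suc k) * sign (m ∸ k) * f (suc k)
               ≡ ι (m C k) * sign (m ∸ k) * f (suc k) + ι (m C suc k) * sign (m ∸ k) * f (suc k)
  pascal k = begin
    ι (suc m C suc k) * sign (m ∸ k) * f (suc k)
      ≡⟨ cong (λ c → ι c * sign (m ∸ k) * f (suc k)) (nCk+nC[k+1]≡[n+1]C[k+1] m k) ⟨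
    ι (m C k ℕ.+ m C suc k) * sign (m ∸ k) * f (suc k)
      ≡⟨ cong (λ c → c * sign (m ∸ k) * f (suc k)) (ι-+ (m C k) (m C suc k)) ⟩
    (ι (m C k) + ι (m C suc k)) * sign (m ∸ k) * f (suc k)
      ≡⟨ cong (_* f (suc k)) (ℚ.*-distribʳ-+ (sign (m ∸ k)) (ι (m C k)) (ι (m C suc k))) ⟩
    (ι (m C k) * sign (m ∸ k) + ι (m C suc k) * sign (m ∸ k)) * f (suc k)
      ≡⟨ ℚ.*-distribʳ-+ (f (suc k)) (ι (m C k) * sign (m ∸ k)) (ι (m C suc k) * sign (m ∸ k)) ⟩
    ι (m C k) * sign (m ∸ k) * f (suc k) + ι (m C suc k) * sign (m ∸ k) * f (suc k) ∎

nCk*k!*[n∸k]!≡n! : ∀ {n k} → k ≤ n → (n C k) ℕ.* (k ! ℕ.* (n ∸ k) !) ≡ n !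
nCk*k!*[n∸k]!≡n! {n} {k} k≤n = trans (cong (ℕ._* (k ! ℕ.* (n ∸ k) !)) (nCk≡n!/k![n-k]! k≤n))
  (m/n*n≡m {{k !* (n ∸ k) !≢0}} (k![n∸k]!∣n! k≤n))

C-absorption : ∀ m k → (suc m ∸ k) ℕ.* (suc m C k) ≡ suc m ℕ.* (m C k)
C-absorption m k with k ℕ.≤? m
... | no k≰m rewrite ℕ.m≤n⇒m∸n≡0 (ℕ.≰⇒> k≰m) | k>n⇒nCk≡0 (ℕ.≰⇒> k≰m) = sym (ℕ.*-zeroʳ (suc m))
... | yes k≤m = ℕ.*-cancelʳ-≡ _ _ (k ! ℕ.* d !) {{k !* d !≢0}} (begin
    (suc m ∸ k) ℕ.* (suc m C k) ℕ.* (k ! ℕ.* d !)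
  ≡⟨ cong (λ e → e ℕ.* (suc m C k) ℕ.* (k ! ℕ.* d !)) (ℕ.+-∸-assoc 1 k≤m) ⟩
    suc d ℕ.* (suc m C k) ℕ.* (k ! ℕ.* d !)
  ≡⟨ ℕS.solve 4 (λ a b c e → a :* b :* (c :* e) := b :* (c :* (a :* e))) refl (suc d) (suc m C k) (k !) (d !) ⟩
    (suc m C k) ℕ.* (k ! ℕ.* suc d !)
  ≡⟨ cong (λ e → (suc m C k) ℕ.* (k ! ℕ.* e !)) (ℕ.+-∸-assoc 1 k≤m) ⟨
    (suc m C k) ℕ.* (k ! ℕ.* (suc m ∸ k) !)
  ≡⟨ nCk*k!*[n∸k]!≡n! (ℕ.m≤n⇒m≤1+n k≤m) ⟩
    suc m ℕ.* m !
  ≡⟨ cong (suc m ℕ.*_) (nCk*k!*[n∸k]!≡n! k≤m) ⟨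
    suc m ℕ.* ((m C k) ℕ.* (k ! ℕ.* d !))
  ≡⟨ ℕ.*-assoc (suc m) (m C k) (k ! ℕ.* d !) ⟨
    suc m ℕ.* (m C k) ℕ.* (k ! ℕ.* d !)
  ∎)
  where
  open ℕS using (_:*_; _:=_)
  d = m ∸ k

Δⁿ-ι* : ∀ m f → Δⁿ (suc m) (λ k → ι k * f k) ≡ ι (suc m) * (Δⁿ (suc m) f + Δⁿ m f)
Δⁿ-ι* m f = begin
    Δⁿ (suc m) (λ k → ι k * f k)
  ≡⟨ sumTo-cong (suc m) split ⟩
    sumTo (suc m) (λ k → M * G k + - (M * H k))
  ≡⟨ sumTo-distrib-+ (suc m) _ _ ⟩
    sumTo (suc m) (λ k → M * G k) + sumTo (suc m) (λ k → - (M * H k))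
  ≡⟨ cong₂ _+_ (*-distribˡ-sumTo (suc m) M G)
               (trans (cong -_ (*-distribˡ-sumTo (suc m) M H)) (neg-distrib-sumTo (suc m) _)) ⟨
    M * Δⁿ (suc m) f - M * sumTo (suc m) H
  ≡⟨ cong (λ h → M * Δⁿ (suc m) f - M * h) (Δⁿ-sign-flip m f) ⟩
    M * Δⁿ (suc m) f - M * - Δⁿ m f
  ≡⟨ solve 3 (λ M a b → M :* a :- M :* (:- b) := M :* (a :+ b)) refl M (Δⁿ (suc m) f) (Δⁿ m f) ⟩
    M * (Δⁿ (suc m) f + Δⁿ m f)
  ∎
  where
  open ℚS
  M : ℚ
  M = ι (suc m)
  G H : ℕ → ℚ
  G k = ι (suc m C k) * sign (suc m ∸ k) * f k
  H k = ι (m C k) * sign (suc m ∸ k) * f k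
  -- k = (m + 1) − (m + 1 − k), and (m + 1 − k) C(m + 1, k) = (m + 1) C(m, k) absorbs the second part.
  split : ∀ k → k ≤ suc m → ι (suc m C k) * sign (suc m ∸ k) * (ι k * f k) ≡ M * G k + - (M * H k)
  split k k≤1+m = begin
      c₁ * s * (ι k * f k)
    ≡⟨ solve 5 (λ c₁ s K d v → c₁ :* s :* (K :* v) := (K :+ d) :* (c₁ :* s :* v) :- d :* c₁ :* (s :* v)) refl
               c₁ s (ι k) d (f k) ⟩
      (ι k + d) * G k - d * c₁ * (s * f k)
    ≡⟨ cong₂ (λ a b → a * G k - b * (s * f k)) (sym (ι-split k≤1+m)) absorbed ⟩
      M * G k - M * ι (m C k) * (s * f k)
    ≡⟨ cong (λ h → M * G k - h)
            (trans (ℚ.*-assoc M (ι (m C k)) (s * f k)) (cong (M *_) (sym (ℚ.*-assoc (ι (m C k)) s (f k))))) ⟩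
      M * G k - M * H k
    ∎
    where
    c₁ = ι (suc m C k)
    s = sign (suc m ∸ k)
    d = ι (suc m ∸ k)
    absorbed : d * c₁ ≡ M * ι (m C k)
    absorbed = trans (sym (ι-* (suc m ∸ k) (suc m C k))) (trans (cong ι (C-absorption m k)) (ι-* (suc m) (m C k)))

Δⁿ-power : ∀ j m → Δⁿ m (λ k → ι k ^q j) ≡ ι (m !) * ι (S j m)
Δⁿ-power zero    zero    = refl
Δⁿ-power zero    (suc m) =
  trans (Δⁿ-suc m (λ _ → 1ℚ)) (trans (ℚ.+-inverseʳ (Δⁿ m (λ _ → 1ℚ))) (sym (ℚ.*-zeroʳ (ι (suc m !)))))
Δⁿ-power (suc j) zero    = y≡0⇒x*y≡0 (ι 1 * 1ℚ) (ℚ.*-zeroˡ (ι 0 ^q j))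
Δⁿ-power (suc j) (suc m) = begin
    Δⁿ (suc m) (λ k → ι k * xʲ k)
  ≡⟨ Δⁿ-ι* m xʲ ⟩
    ι (suc m) * (Δⁿ (suc m) xʲ + Δⁿ m xʲ)
  ≡⟨ cong (ι (suc m) *_) (cong₂ _+_ (Δⁿ-power j (suc m)) (Δⁿ-power j m)) ⟩
    ι (suc m) * (ι (suc m !) * ι (S j (suc m)) + ι (m !) * ι (S j m))
  ≡⟨ !*S-suc j m ⟩
    ι (suc m !) * ι (S (suc j) (suc m))
  ∎
  where
  xʲ : ℕ → ℚ
  xʲ k = ι k ^q j

-- Powers of the Stirling matrix

δ-≢ : ∀ {n m} → n ≢ m → δ n m ≡ 0
δ-≢ {zero}  {zero}  n≢m = ⊥-elim (n≢m refl)
δ-≢ {zero}  {suc m} _   = refl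
δ-≢ {suc n} {zero}  _   = refl
δ-≢ {suc n} {suc m} n≢m = δ-≢ (n≢m ∘ cong suc)

δ-refl : ∀ n → δ n n ≡ 1
δ-refl zero    = refl
δ-refl (suc n) = δ-refl n

sumTo-*δ : ∀ {n m} (f : ℕ → ℚ) → m ≤ n → sumTo n (λ k → f k * ι (δ k m)) ≡ f m
sumTo-*δ {n} {m} f m≤n = begin
    sumTo n (λ k → f k * ι (δ k m))  ≡⟨ sumTo-pad _ m≤n (λ k m<k → off-diagonal k (ℕ.>⇒≢ m<k)) ⟩
    sumTo m (λ k → f k * ι (δ k m))  ≡⟨ sumTo-last m _ (λ k k<m → off-diagonal k (ℕ.<⇒≢ k<m)) ⟩
    f m * ι (δ m m)                  ≡⟨ trans (cong (λ e → f m * ι e) (δ-refl m)) (ℚ.*-identityʳ (f m)) ⟩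
    f m                              ∎
  where
  off-diagonal : ∀ k → k ≢ m → f k * ι (δ k m) ≡ 0ℚ
  off-diagonal k k≢m = y≡0⇒x*y≡0 (f k) (cong ι (δ-≢ k≢m))

sumTo-δ* : ∀ n (f : ℕ → ℚ) → sumTo n (λ j → ι (δ n j) * f j) ≡ f n
sumTo-δ* n f = begin
    sumTo n (λ j → ι (δ n j) * f j)
  ≡⟨ sumTo-last n _ (λ j j<n → x≡0⇒x*y≡0 (f j) (cong ι (δ-≢ (ℕ.>⇒≢ j<n)))) ⟩
    ι (δ n n) * f n
  ≡⟨ trans (cong (λ e → ι e * f n) (δ-refl n)) (ℚ.*-identityˡ (f n)) ⟩
    f n
  ∎

S-triangular : ∀ {n m} → n < m → S n m ≡ 0
S-triangular {zero}  {suc m} _         = refl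
S-triangular {suc n} {suc m} (s≤s n<m)
  rewrite S-triangular (ℕ.m<n⇒m<1+n n<m) | S-triangular n<m = trans (ℕ.+-identityʳ (m ℕ.* 0)) (ℕ.*-zeroʳ m)

Sᵖ-triangular : ∀ p {n m} → n < m → ι (Sᵖ p n m) ≡ 0ℚ
Sᵖ-triangular zero    n<m = cong ι (δ-≢ (ℕ.<⇒≢ n<m))
Sᵖ-triangular (suc p) {n} {m} n<m = trans (ι-Sᵖ-suc p n m)
  (sumTo-zero n _ (λ k k≤n → y≡0⇒x*y≡0 (ι (S n k)) (Sᵖ-triangular p (ℕ.≤-<-trans k≤n n<m))))

sumTo-triangular-assoc : ∀ n (A : ℕ → ℚ) (B : ℕ → ℕ → ℚ) (C : ℕ → ℚ) →
  (∀ k j → k < j → B k j ≡ 0ℚ) →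
  sumTo n (λ k → A k * sumTo k (λ j → B k j * C j)) ≡ sumTo n (λ j → sumTo n (λ k → A k * B k j) * C j)
sumTo-triangular-assoc n A B C B-triangular = begin
    sumTo n (λ k → A k * sumTo k (λ j → B k j * C j))
  ≡⟨ sumTo-cong n (λ k k≤n → cong (A k *_) (sym (sumTo-pad _ k≤n (λ j k<j →
       x≡0⇒x*y≡0 (C j) (B-triangular k j k<j))))) ⟩
    sumTo n (λ k → A k * sumTo n (λ j → B k j * C j))
  ≡⟨ sumTo-cong-≗ n (λ k → *-distribˡ-sumTo n (A k) _) ⟩
    sumTo n (λ k → sumTo n (λ j → A k * (B k j * C j)))
  ≡⟨ sumTo-comm n n _ ⟩
    sumTo n (λ j → sumTo n (λ k → A k * (B k j * C j)))
  ≡⟨ sumTo-cong-≗ n (λ j → trans (sumTo-cong-≗ n (λ k → sym (ℚ.*-assoc (A k) (B k j) (C j))))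
                                 (sym (*-distribʳ-sumTo n (C j) _))) ⟩
    sumTo n (λ j → sumTo n (λ k → A k * B k j) * C j)
  ∎

-- Sᵖ multiplies by 𝒮 on the left; part (ii) needs the product on the right.
Sᵖ-suc-right : ∀ p n m → ι (Sᵖ (suc p) n m) ≡ sumTo n (λ j → ι (Sᵖ p n j) * ι (S j m))
Sᵖ-suc-right zero n m = begin
    ι (Sᵖ 1 n m)                                ≡⟨ ι-Sᵖ-suc 0 n m ⟩
    sumTo n (λ k → ι (S n k) * ι (δ k m))       ≡⟨ 𝒮·I≡𝒮 ⟩
    ι (S n m)                                   ≡⟨ sumTo-δ* n (λ j → ι (S j m)) ⟨
    sumTo n (λ j → ι (δ n j) * ι (S j m))       ∎
  where
  𝒮·I≡𝒮 : sumTo n (λ k → ι (S n k) * ι (δ k m)) ≡ ι (S n m)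
  𝒮·I≡𝒮 with m ℕ.≤? n
  ... | yes m≤n = sumTo-*δ (ι ∘ S n) m≤n
  ... | no  m≰n = trans
    (sumTo-zero n _ (λ k k≤n → y≡0⇒x*y≡0 (ι (S n k)) (cong ι (δ-≢ (ℕ.<⇒≢ (ℕ.≤-<-trans k≤n n<m))))))
    (sym (cong ι (S-triangular n<m)))
    where n<m = ℕ.≰⇒> m≰n
Sᵖ-suc-right (suc p) n m = begin
    ι (Sᵖ (suc (suc p)) n m)
  ≡⟨ ι-Sᵖ-suc (suc p) n m ⟩
    sumTo n (λ k → ι (S n k) * ι (Sᵖ (suc p) k m))
  ≡⟨ sumTo-cong-≗ n (λ k → cong (ι (S n k) *_) (Sᵖ-suc-right p k m)) ⟩
    sumTo n (λ k → ι (S n k) * sumTo k (λ j → ι (Sᵖ p k j) * ι (S j m)))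
  ≡⟨ sumTo-triangular-assoc n (ι ∘ S n) (λ k j → ι (Sᵖ p k j)) (λ j → ι (S j m)) (λ k j → Sᵖ-triangular p) ⟩
    sumTo n (λ j → sumTo n (λ k → ι (S n k) * ι (Sᵖ p k j)) * ι (S j m))
  ≡⟨ sumTo-cong-≗ n (λ j → cong (_* ι (S j m)) (ι-Sᵖ-suc p n j)) ⟨
    sumTo n (λ j → ι (Sᵖ (suc p) n j) * ι (S j m))
  ∎

Sᵖ-via-Bell : ∀ p n m → 1 ≤ p → ι (Sᵖ p n m) ≡ expˢ m * Δⁿ m (λ k → B (p ∸ 1) n (ι k))
Sᵖ-via-Bell (suc p) n m _ = sym (begin
    expˢ m * Δⁿ m (λ k → B p n (ι k))
  ≡⟨ cong (expˢ m *_) (sumTo-cong-≗ m (λ k →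
       cong (ι (m C k) * sign (m ∸ k) *_) (Bell-expansion p n (ι k)))) ⟩
    expˢ m * Δⁿ m (λ k → sumTo n (λ j → Sᵖₙ j * (ι k ^q j)))
  ≡⟨ cong (expˢ m *_) (Δⁿ-sumTo m n Sᵖₙ (λ j k → ι k ^q j)) ⟩
    expˢ m * sumTo n (λ j → Sᵖₙ j * Δⁿ m (λ k → ι k ^q j))
  ≡⟨ cong (expˢ m *_) (sumTo-cong-≗ n (λ j → cong (Sᵖₙ j *_) (Δⁿ-power j m))) ⟩
    expˢ m * sumTo n (λ j → Sᵖₙ j * (ι (m !) * ι (S j m)))
  ≡⟨ cong (expˢ m *_) (trans (sumTo-cong-≗ n (λ j → *ᶜ.x∙yz≈y∙xz (Sᵖₙ j) (ι (m !)) (ι (S j m))))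
                             (sym (*-distribˡ-sumTo n (ι (m !)) _))) ⟩
    expˢ m * (ι (m !) * Σⱼ)
  ≡⟨ trans (sym (ℚ.*-assoc (expˢ m) (ι (m !)) Σⱼ))
           (trans (cong (_* Σⱼ) (expˢ*ι!≡1 m)) (ℚ.*-identityˡ Σⱼ)) ⟩
    Σⱼ
  ≡⟨ Sᵖ-suc-right p n m ⟨
    ι (Sᵖ (suc p) n m)
  ∎)
  where
  Sᵖₙ : ℕ → ℚ
  Sᵖₙ j = ι (Sᵖ p n j)
  Σⱼ : ℚ
  Σⱼ = sumTo n (λ j → Sᵖₙ j * ι (S j m))

proposition3 : ((p n : ℕ) (x : ℚ) → B p n x ≡ sumTo n (λ m → ι (Sᵖ p n m) * (x ^q m)))
    × ((p n m : ℕ) → 1 ≤ p →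
        ι (Sᵖ p n m)
          ≡ _/_ (+ 1) (m !) ⦃ m !≢0 ⦄
            * sumTo m (λ k → ι (m C k) * sign (m ∸ k) * B (p ∸ 1) n (ι k)))
proposition3 = Bell-expansion , Sᵖ-via-Bell
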